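{- Let $n \geq 3$ and let $GP(n,1)$ be the prism graph. Then $Z_{(\ell)}(GP(n,1)) = 3$ if $\ell \in \{0,1\}$ and $n=3$; $Z_{(\ell)}(GP(n,1)) = 4$ if $\ell\in\{0,1\}$ and $n \geq 4$, or if $\ell = 2$ and $n = 3$; and $Z_{(\ell)}(GP(n,1)) = 2n$ if $\ell \geq 3$. Furthermore, $Z_{(2)}(GP(3,1)) = 4$, $Z_{(2)}(GP(4,1)) \leq 6$, and $Z_{(2)}(GP(n,1)) \leq n$ for $n > 4$.
   Context: Let $G=(V,E)$ be a finite simple graph. Color change rule: a colored (blue) vertex $v$ colors (forces) an uncolored vertex $u$ if $u$ is the only uncolored neighbor of $v$. In $\ell$-leaky forcing, after an initial set $B\subseteq V$ is colored, an adversary places leaks on at most $\ell$ vertices; a vertex with a leak never forces. $B$ is an $\ell$-leaky forcing set if for every placement of at most $\ell$ leaks, repeatedly applying the color change rule (with leaky vertices unable to force) eventually colors all of $V$. $Z_{(\ell)}(G)$ is the minimum size of an $\ell$-leaky forcing set ($\ell = 0$ is ordinary zero forcing). The prism graph $GP(n,1)$ consists of two vertex-disjoint $n$-cycles $u_1,\dots,u_n$ and $x_1,\dots,x_n$ together with the $n$ edges $u_ix_i$, $1\le i\le n$. -}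

module Defs where

open import Data.Nat using (ℕ; zero; suc; _+_; _≤_; _%_)
open import Data.Fin using (Fin; toℕ; splitAt)
open import Data.Fin.Subset using (Subset; _∈_; _∉_; ∣_∣)
open import Data.Sum using (_⊎_; inj₁; inj₂)
open import Data.Product using (Σ; _×_; _,_; ∃)
open import Data.Empty using (⊥)
open import Relation.Nullary using (¬_)
open import Relation.Binary.PropositionalEquality using (_≡_)

-- A graph on vertex set Fin N is given by its adjacency relation (for the prism below
-- it is symmetric and irreflexive when n ≥ 3, i.e. a simple graph).
Graph : ℕ → Set₁
Graph N = Fin N → Fin N → Set

-- Inductive closure of the colour change rule: w (blue, not leaky) forces v when
-- v is a neighbour of w and every other neighbour of w is already blue.
-- (The final colored set does not depend on the order of forces.)
data Colored {N : ℕ} (G : Graph N) (B L : Subset N) : Fin N → Set where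
  initial : ∀ {v} → v ∈ B → Colored G B L v
  force   : ∀ {w v} → Colored G B L w → w ∉ L → G w v →
            (∀ u → G w u → ¬ (u ≡ v) → Colored G B L u) →
            Colored G B L v

IsLeakyForcingSet : ∀ {N} → Graph N → ℕ → Subset N → Set
IsLeakyForcingSet {N} G ℓ B = ∀ (L : Subset N) → ∣ L ∣ ≤ ℓ → ∀ v → Colored G B L v

LeakyZ≡ : ∀ {N} → Graph N → ℕ → ℕ → Set
LeakyZ≡ {N} G ℓ k =
  Σ (Subset N) (λ B → IsLeakyForcingSet G ℓ B × ∣ B ∣ ≡ k)
  × (∀ B → IsLeakyForcingSet G ℓ B → k ≤ ∣ B ∣)

LeakyZ≤ : ∀ {N} → Graph N → ℕ → ℕ → Set
LeakyZ≤ {N} G ℓ k = Σ (Subset N) (λ B → IsLeakyForcingSet G ℓ B × ∣ B ∣ ≤ k)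

-- Cycle C_n on Fin n (intended for n ≥ 3): i ~ j iff j ≡ i+1 (mod n) or i ≡ j+1 (mod n).
CycleAdj : ∀ n → Fin n → Fin n → Set
CycleAdj zero    i j = ⊥
CycleAdj (suc m) i j = (toℕ j ≡ (suc (toℕ i)) % suc m) ⊎ (toℕ i ≡ (suc (toℕ j)) % suc m)

-- Prism GP(n,1) on Fin (n + n): inj₁ i (left part) is u_i, inj₂ i (right part) is x_i.
PrismAdj' : ∀ n → Fin n ⊎ Fin n → Fin n ⊎ Fin n → Set
PrismAdj' n (inj₁ i) (inj₁ j) = CycleAdj n i j
PrismAdj' n (inj₂ i) (inj₂ j) = CycleAdj n i j
PrismAdj' n (inj₁ i) (inj₂ j) = i ≡ j
PrismAdj' n (inj₂ i) (inj₁ j) = i ≡ j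

PrismAdj : ∀ n → Graph (n + n)
PrismAdj n a b = PrismAdj' n (splitAt n a) (splitAt n b)

-- Every vertex of GP(n,1) has degree 3, so three leaks can surround any vertex outside B: only V forces.
-- For fewer leaks consider the first force from B.  Its forcing vertex w lies in B together with all but
-- one of its neighbours, so |B| ≥ 3; and if |B| = 3 then B ⊆ N[w], which is closed under forcing when
-- n ≥ 4, and also when n = 3 once both cycle neighbours of w leak, so then |B| ≥ 4.  Conversely one whole
-- cycle {uᵢ} forces: xᵢ is forced by uᵢ, or along the x-cycle from xᵢ₋₁ or xᵢ₊₁, and one leak (two when
-- n ≥ 5) cannot block all three routes.  The ladder {u₀, u₁, x₀, x₁} survives one leak by sweeping around
-- both cycles from either end towards the leaky column; for two leaks and n = 3, 4 a case analysis remains.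
module Submission where

open import Defs
open import Data.Bool using (Bool; true; false; not)
open import Data.Bool.Properties using (not-involutive)
open import Data.Empty using (⊥-elim)
open import Data.Fin as F using (Fin; toℕ; fromℕ<; _↑ˡ_; splitAt)
import Data.Fin.Properties as FP
open import Data.Fin.Subset using (Subset; _∈_; _∉_; ∣_∣; ⁅_⁆; _∪_; ⊤; ⊥; inside)
open import Data.Fin.Subset.Properties
  using (_∈?_; ∈⊤; ∣p∣≤n; x∈⁅x⁆; ∣⁅x⁆∣≡1; ∣⊥∣≡0; ∣⊤∣≡n; x∈p∪q⁺; x∈p⇒∣p-x∣<∣p∣; x∈p∧x≢y⇒x∈p-y; p⊆q⇒∣p∣≤∣q∣)
open import Data.List using (List; []; _∷_; length; foldr)
open import Data.List.Membership.Propositional using (find) renaming (_∈_ to _∈ₗ_; _∉_ to _∉ₗ_)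
open import Data.List.Relation.Unary.All as All using (All; []; _∷_)
open import Data.List.Relation.Unary.All.Properties using (¬Any⇒All¬)
open import Data.List.Relation.Unary.AllPairs using ([]; _∷_)
open import Data.List.Relation.Unary.Any using (here; there; any?)
open import Data.List.Relation.Unary.Unique.Propositional using (Unique)
open import Data.Nat using (ℕ; zero; suc; _+_; _∸_; _≤_; _<_; z≤n; s≤s; z<s; s<s; _%_; NonZero; >-nonZero⁻¹; _≤?_)
open import Data.Nat.DivMod using (%-distribˡ-+; m%n%n≡m%n; [m+n]%n≡m%n; m<n⇒m%n≡m; m%n<n; n%n≡0)
open import Data.Nat.Properties
open import Algebra.Properties.CommutativeSemigroup +-commutativeSemigroup using (x∙yz≈y∙xz)
open import Data.Product using (Σ; ∃; ∃₂; _×_; _,_; proj₁; proj₂)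
open import Data.Sum as Sum using (_⊎_; inj₁; inj₂)
open import Data.Vec using ([]; _∷_; _++_)
open import Data.Vec.Properties using (lookup⇒[]=; lookup-++ˡ; lookup-replicate)
open import Function using (_∘_; id; case_of_)
open import Relation.Binary.Definitions using (tri<; tri≈; tri>)
open import Relation.Binary.PropositionalEquality
open import Relation.Nullary using (¬_; yes; no)
open import Relation.Nullary.Decidable using (decidable-stable)

∣p∪q∣≤∣p∣+∣q∣ : ∀ {m} (p q : Subset m) → ∣ p ∪ q ∣ ≤ ∣ p ∣ + ∣ q ∣
∣p∪q∣≤∣p∣+∣q∣ []          []          = z≤n
∣p∪q∣≤∣p∣+∣q∣ (true ∷ p)  (true ∷ q)  = s≤s (≤-trans (m≤n⇒m≤1+n (∣p∪q∣≤∣p∣+∣q∣ p q)) (≤-reflexive (sym (+-suc _ _))))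
∣p∪q∣≤∣p∣+∣q∣ (true ∷ p)  (false ∷ q) = s≤s (∣p∪q∣≤∣p∣+∣q∣ p q)
∣p∪q∣≤∣p∣+∣q∣ (false ∷ p) (true ∷ q)  = ≤-trans (s≤s (∣p∪q∣≤∣p∣+∣q∣ p q)) (≤-reflexive (sym (+-suc _ _)))
∣p∪q∣≤∣p∣+∣q∣ (false ∷ p) (false ∷ q) = ∣p∪q∣≤∣p∣+∣q∣ p q

∀∈⇒∣p∣≡n : ∀ {m} (p : Subset m) → (∀ v → v ∈ p) → ∣ p ∣ ≡ m
∀∈⇒∣p∣≡n {m} p all∈ =
  ≤-antisym (∣p∣≤n p) (≤-trans (≤-reflexive (sym (∣⊤∣≡n m))) (p⊆q⇒∣p∣≤∣q∣ {p = ⊤} (λ {x} _ → all∈ x)))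

∣⊤++⊥∣≡m : ∀ m l → ∣ ⊤ {m} ++ ⊥ {l} ∣ ≡ m
∣⊤++⊥∣≡m zero    l = ∣⊥∣≡0 l
∣⊤++⊥∣≡m (suc m) l = cong suc (∣⊤++⊥∣≡m m l)

↑ˡ∈⊤++⊥ : ∀ {m} l (i : Fin m) → i ↑ˡ l ∈ ⊤ ++ ⊥ {l}
↑ˡ∈⊤++⊥ {m} l i = lookup⇒[]= (i ↑ˡ l) (⊤ {m} ++ ⊥ {l}) (trans (lookup-++ˡ ⊤ ⊥ i) (lookup-replicate i inside))

fromList : ∀ {m} → List (Fin m) → Subset m
fromList = foldr (λ x p → ⁅ x ⁆ ∪ p) ⊥

∣fromList∣≤length : ∀ {m} (xs : List (Fin m)) → ∣ fromList xs ∣ ≤ length xs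
∣fromList∣≤length {m} []       = ≤-reflexive (∣⊥∣≡0 m)
∣fromList∣≤length (x ∷ xs) =
  ≤-trans (∣p∪q∣≤∣p∣+∣q∣ ⁅ x ⁆ _) (+-mono-≤ (≤-reflexive (∣⁅x⁆∣≡1 x)) (∣fromList∣≤length xs))

∈fromList⁺ : ∀ {m} {x : Fin m} {xs} → x ∈ₗ xs → x ∈ fromList xs
∈fromList⁺ (here refl)  = x∈p∪q⁺ (inj₁ (x∈⁅x⁆ _))
∈fromList⁺ (there x∈xs) = x∈p∪q⁺ (inj₂ (∈fromList⁺ x∈xs))

length≤∣p∣ : ∀ {m} {p : Subset m} {xs} → Unique xs → All (_∈ p) xs → length xs ≤ ∣ p ∣
length≤∣p∣ []           []           = z≤n
length≤∣p∣ (x≢xs ∷ uxs) (x∈p ∷ xs∈p) = ≤-trans (s≤s (length≤∣p∣ uxs xs∈p-x)) (x∈p⇒∣p-x∣<∣p∣ x∈p)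
  where
  xs∈p-x = All.zipWith (λ (x≢y , y∈p) → x∈p∧x≢y⇒x∈p-y y∈p (x≢y ∘ sym)) (x≢xs , xs∈p)

∣fromList∣≡length : ∀ {m} {xs : List (Fin m)} → Unique xs → ∣ fromList xs ∣ ≡ length xs
∣fromList∣≡length {xs = xs} uxs = ≤-antisym (∣fromList∣≤length xs) (length≤∣p∣ uxs (All.tabulate ∈fromList⁺))

∣p∣≤1⇒⊆singleton : ∀ {m} {p : Subset m} → Fin m → ∣ p ∣ ≤ 1 → ∃ λ x → ∀ {y} → y ≢ x → y ∉ p
∣p∣≤1⇒⊆singleton {p = p} x₀ ∣p∣≤1 with FP.any? (_∈? p)
... | no  none      = x₀ , λ {y} _ y∈p → none (y , y∈p)
... | yes (x , x∈p) = x , λ y≢x y∈p → <⇒≱ (length≤∣p∣ ((y≢x ∷ []) ∷ [] ∷ []) (y∈p ∷ x∈p ∷ [])) ∣p∣≤1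

∣p∣≤2⇒∉ : ∀ {m} {p : Subset m} {a b y} → ∣ p ∣ ≤ 2 → a ∈ p → b ∈ p → a ≢ b → a ≢ y → b ≢ y → y ∉ p
∣p∣≤2⇒∉ ∣p∣≤2 a∈p b∈p a≢b a≢y b≢y y∈p =
  <⇒≱ (length≤∣p∣ ((a≢b ∷ a≢y ∷ []) ∷ (b≢y ∷ []) ∷ [] ∷ []) (a∈p ∷ b∈p ∷ y∈p ∷ [])) ∣p∣≤2

some∈⊎all∉ : ∀ {m} (p : Subset m) xs → (∃ λ x → x ∈ₗ xs × x ∈ p) ⊎ All (_∉ p) xs
some∈⊎all∉ p xs with any? (_∈? p) xs
... | yes some = inj₁ (find some)
... | no  none = inj₂ (¬Any⇒All¬ xs none)

Covers_AllBut : ∀ {m} → Subset m → Fin m → List (Fin m) → Set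
Covers p AllBut x xs = ∀ {y} → y ∈ₗ xs → y ≢ x → y ∈ p

module _ {m} {p : Subset m} {x : Fin m} {xs : List (Fin m)} (uxs : Unique xs) (cover : Covers p AllBut x xs) where
  open import Data.List.Membership.DecPropositional (F._≟_ {m}) using () renaming (_∈?_ to _∈ₗ?_)

  private
    xs⊆p∪⁅x⁆ : ∀ {y} → y ∈ₗ xs → y ∈ p ∪ ⁅ x ⁆
    xs⊆p∪⁅x⁆ {y} y∈xs with y F.≟ x
    ... | yes refl = x∈p∪q⁺ (inj₂ (x∈⁅x⁆ x))
    ... | no  y≢x  = x∈p∪q⁺ (inj₁ (cover y∈xs y≢x))

    ∣p∪⁅x⁆∣≤1+∣p∣ : ∣ p ∪ ⁅ x ⁆ ∣ ≤ suc ∣ p ∣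
    ∣p∪⁅x⁆∣≤1+∣p∣ = ≤-trans (∣p∪q∣≤∣p∣+∣q∣ p ⁅ x ⁆) (≤-reflexive (trans (cong (∣ p ∣ +_) (∣⁅x⁆∣≡1 x)) (+-comm ∣ p ∣ 1)))

  length≤1+∣p∣ : length xs ≤ suc ∣ p ∣
  length≤1+∣p∣ = ≤-trans (length≤∣p∣ uxs (All.tabulate xs⊆p∪⁅x⁆)) ∣p∪⁅x⁆∣≤1+∣p∣

  ∈-if-∣p∣<length : ∣ p ∣ < length xs → ∀ {y} → y ∈ p → y ∈ₗ xs
  ∈-if-∣p∣<length ∣p∣<len {y} y∈p = decidable-stable (y ∈ₗ? xs) λ y∉xs →
    <⇒≱ ∣p∣<len (≤-pred (≤-trans (length≤∣p∣ (y∷xs-unique y∉xs) (x∈p∪q⁺ (inj₁ y∈p) ∷ All.tabulate xs⊆p∪⁅x⁆))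
                                  ∣p∪⁅x⁆∣≤1+∣p∣))
    where
    y∷xs-unique : y ∉ₗ xs → Unique (y ∷ xs)
    y∷xs-unique y∉xs = All.tabulate (λ z∈xs y≡z → y∉xs (subst (_∈ₗ xs) (sym y≡z) z∈xs)) ∷ uxs

module _ {n : ℕ} .{{_ : NonZero n}} where
  open ≡-Reasoning

  0%n≡0 : 0 % n ≡ 0
  0%n≡0 = m<n⇒m%n≡m (>-nonZero⁻¹ n)

  %-congʳ-+ : ∀ {x y} c → x % n ≡ y % n → (c + x) % n ≡ (c + y) % n
  %-congʳ-+ {x} {y} c x≡y = begin
    (c + x) % n          ≡⟨ %-distribˡ-+ c x n ⟩
    (c % n + x % n) % n  ≡⟨ cong (λ z → (c % n + z) % n) x≡y ⟩
    (c % n + y % n) % n  ≡⟨ %-distribˡ-+ c y n ⟨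
    (c + y) % n          ∎

  suc-% : ∀ x → suc (x % n) % n ≡ suc x % n
  suc-% x = %-congʳ-+ 1 (m%n%n≡m%n x n)

  suc-injective-% : ∀ {x y} → suc x % n ≡ suc y % n → x % n ≡ y % n
  suc-injective-% {x} {y} e = begin
    x % n                 ≡⟨ [m+n]%n≡m%n x n ⟨
    (x + n) % n           ≡⟨ cong (_% n) (x+n≡[n∸1]+[1+x] x) ⟩
    ((n ∸ 1) + suc x) % n ≡⟨ %-congʳ-+ (n ∸ 1) e ⟩
    ((n ∸ 1) + suc y) % n ≡⟨ cong (_% n) (x+n≡[n∸1]+[1+x] y) ⟨
    (y + n) % n           ≡⟨ [m+n]%n≡m%n y n ⟩
    y % n                 ∎
    where
    x+n≡[n∸1]+[1+x] : ∀ x → x + n ≡ (n ∸ 1) + suc x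
    x+n≡[n∸1]+[1+x] x = begin
      x + n            ≡⟨ +-comm x n ⟩
      n + x            ≡⟨ cong (_+ x) (m∸n+n≡m (>-nonZero⁻¹ n)) ⟨
      (n ∸ 1) + 1 + x  ≡⟨ +-assoc (n ∸ 1) 1 x ⟩
      (n ∸ 1) + suc x  ∎

  +-cancelˡ-% : ∀ {x y} c → (c + x) % n ≡ (c + y) % n → x % n ≡ y % n
  +-cancelˡ-% zero    e = e
  +-cancelˡ-% (suc c) e = +-cancelˡ-% c (suc-injective-% e)

  [d+x]%n≢x%n : ∀ {d} x → 0 < d → d < n → (d + x) % n ≢ x % n
  [d+x]%n≢x%n {d} x 0<d d<n e = <⇒≢ 0<d (sym (begin
    d      ≡⟨ m<n⇒m%n≡m d<n ⟨
    d % n  ≡⟨ +-cancelˡ-% x (subst₂ (λ a b → a % n ≡ b % n) (+-comm d x) (sym (+-identityʳ x)) e) ⟩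
    0 % n  ≡⟨ 0%n≡0 ⟩
    0      ∎))

  %-distinct : ∀ {a b} → 1 ≤ a → a < b → b ≤ n → a % n ≢ b % n
  %-distinct {a} {b} 1≤a a<b b≤n a≡b = [d+x]%n≢x%n a (m<n⇒0<n∸m a<b) d<n (trans (cong (_% n) d+a≡b) (sym a≡b))
    where
    d+a≡b : (b ∸ a) + a ≡ b
    d+a≡b = m∸n+n≡m (<⇒≤ a<b)
    d<n : b ∸ a < n
    d<n = m<n+o⇒m∸n<o b a (≤-trans (s≤s b≤n) (+-monoˡ-≤ n 1≤a))

  %-injective-[1,n] : ∀ {i j} → 1 ≤ i → i ≤ n → 1 ≤ j → j ≤ n → i % n ≡ j % n → i ≡ j
  %-injective-[1,n] {i} {j} 1≤i i≤n 1≤j j≤n i≡j with <-cmp i j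
  ... | tri< i<j _ _ = ⊥-elim (%-distinct 1≤i i<j j≤n i≡j)
  ... | tri≈ _ e _   = e
  ... | tri> _ _ j<i = ⊥-elim (%-distinct 1≤j j<i i≤n (sym i≡j))

  %-representative-[1,n] : ∀ m → m < n → ∃ λ c → 1 ≤ c × c ≤ n × c % n ≡ m % n
  %-representative-[1,n] zero    _   = n , >-nonZero⁻¹ n , ≤-refl , trans (n%n≡0 n) (sym 0%n≡0)
  %-representative-[1,n] (suc m) m<n = suc m , z<s , <⇒≤ m<n , refl

ForceClosed : ∀ {N} → Graph N → Subset N → (Fin N → Set) → Set
ForceClosed G L P = ∀ {w v} → P w → w ∉ L → G w v → (∀ u → G w u → u ≢ v → P u) → P v

FirstForce : ∀ {N} → Graph N → Subset N → Set
FirstForce G B = ∃₂ λ w v → w ∈ B × G w v × v ∉ B × (∀ u → G w u → u ≢ v → u ∈ B)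

module _ {N} {G : Graph N} {B L : Subset N} where

  Colored-ind : (P : Fin N → Set) → (∀ {v} → v ∈ B → P v) → ForceClosed G L P →
                ∀ {v} → Colored G B L v → P v
  Colored-ind P B⊆P closed (initial v∈B)           = B⊆P v∈B
  Colored-ind P B⊆P closed (force cw w∉L wv others) =
    closed (Colored-ind P B⊆P closed cw) w∉L wv (λ u wu u≢v → Colored-ind P B⊆P closed (others u wu u≢v))

  force′ : ∀ {w v} → Colored G B L w → w ∉ L → G w v →
           (∀ u → G w u → u ≡ v ⊎ Colored G B L u) → Colored G B L v
  force′ cw w∉L wv others = force cw w∉L wv λ u wu u≢v → Sum.[ ⊥-elim ∘ u≢v , id ] (others u wu)

  uncolored-if-neighbours-leak : ∀ {w} → w ∉ B → (∀ u → G u w → u ∈ L) → ¬ Colored G B L w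
  uncolored-if-neighbours-leak {w} w∉B leaky cw =
    Colored-ind (_≢ w) (λ v∈B v≡w → w∉B (subst (_∈ B) v≡w v∈B))
      (λ {u} _ u∉L uv _ v≡w → u∉L (leaky u (subst (G u) v≡w uv))) cw refl

  -- Only doubly negated: extracting the force needs decidable adjacency, and each use refutes a
  -- decidable inequality anyway.
  colored⇒firstForce : ∀ {v} → Colored G B L v → v ∉ B → ¬ ¬ FirstForce G B
  colored⇒firstForce cv v∉B noFirst = v∉B (Colored-ind (λ v → ¬ FirstForce G B → v ∈ B) (λ v∈B _ → v∈B)
    (λ {w} {v} w∈B _ wv others noFirst → decidable-stable (v ∈? B)
      (λ v∉B → noFirst (w , v , w∈B noFirst , wv , v∉B , λ u wu u≢v → others u wu u≢v noFirst)))
    cv noFirst)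

isLeakyForcingSet⇒firstForce : ∀ {N} {G : Graph N} {ℓ B} → IsLeakyForcingSet G ℓ B → ∣ B ∣ < N →
                               ¬ ¬ FirstForce G B
isLeakyForcingSet⇒firstForce {N} {B = B} forcing ∣B∣<N
  with FP.¬∀⟶∃¬ N (_∈ B) (_∈? B) (<⇒≢ ∣B∣<N ∘ ∀∈⇒∣p∣≡n B)
... | v , v∉B = colored⇒firstForce (forcing ⊥ (subst (_≤ _) (sym (∣⊥∣≡0 N)) z≤n) v) v∉B

⊤-isLeakyForcingSet : ∀ {N} (G : Graph N) ℓ → IsLeakyForcingSet G ℓ ⊤
⊤-isLeakyForcingSet G ℓ L _ v = initial ∈⊤

isLeakyForcingSet-≤ : ∀ {N} {G : Graph N} {ℓ ℓ′ B} → ℓ′ ≤ ℓ → IsLeakyForcingSet G ℓ B → IsLeakyForcingSet G ℓ′ B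
isLeakyForcingSet-≤ ℓ′≤ℓ forcing L ∣L∣≤ℓ′ = forcing L (≤-trans ∣L∣≤ℓ′ ℓ′≤ℓ)

-- vtx true i is u_(i mod n) and vtx false i is x_(i mod n): indexing by naturals read modulo n lets
-- the cycle neighbours of vtx s (suc i) be written vtx s i and vtx s (2 + i) with no wrap-around case.
module Prism (k : ℕ) where
  n : ℕ
  n = 3 + k

  1<n : 1 < n
  1<n = s<s z<s

  2<n : 2 < n
  2<n = s<s (s<s z<s)

  4≤n+n : 4 ≤ n + n
  4≤n+n = +-mono-≤ {2} {n} {2} {n} (<⇒≤ 2<n) (<⇒≤ 2<n)

  V : Set
  V = Fin (n + n)

  G : Graph (n + n)
  G = PrismAdj n

  idx : ℕ → Fin n
  idx i = fromℕ< (m%n<n i n)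

  toℕ-idx : ∀ i → toℕ (idx i) ≡ i % n
  toℕ-idx i = FP.toℕ-fromℕ< (m%n<n i n)

  idx-toℕ : ∀ f → idx (toℕ f) ≡ f
  idx-toℕ f = FP.toℕ-injective (trans (toℕ-idx (toℕ f)) (m<n⇒m%n≡m (FP.toℕ<n f)))

  side : Bool → Fin n → Fin n ⊎ Fin n
  side true  = inj₁
  side false = inj₂

  vtx : Bool → ℕ → V
  vtx s i = F.join n n (side s (idx i))

  vtx-cong : ∀ s {i j} → i % n ≡ j % n → vtx s i ≡ vtx s j
  vtx-cong s {i} {j} e = cong (F.join n n ∘ side s) (FP.toℕ-injective (trans (toℕ-idx i) (trans e (sym (toℕ-idx j)))))

  vtx-surjective : ∀ v → ∃₂ λ s j → j < n × v ≡ vtx s j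
  vtx-surjective v = lift (splitAt n v) (sym (FP.join-splitAt n n v))
    where
    lift : ∀ x → v ≡ F.join n n x → ∃₂ λ s j → j < n × v ≡ vtx s j
    lift (inj₁ f) e = true  , toℕ f , FP.toℕ<n f , trans e (cong (F.join n n ∘ inj₁) (sym (idx-toℕ f)))
    lift (inj₂ f) e = false , toℕ f , FP.toℕ<n f , trans e (cong (F.join n n ∘ inj₂) (sym (idx-toℕ f)))

  vtx-surjective-+ : ∀ d → d ≤ n → ∀ v → ∃₂ λ s c → v ≡ vtx s (d + c)
  vtx-surjective-+ d d≤n v with vtx-surjective v
  ... | s , j , _ , refl = s , j + (n ∸ d) , vtx-cong s {j} {d + (j + (n ∸ d))} (sym (begin
    (d + (j + (n ∸ d))) % n  ≡⟨ cong (_% n) (x∙yz≈y∙xz d j (n ∸ d)) ⟩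
    (j + (d + (n ∸ d))) % n  ≡⟨ cong (λ z → (j + z) % n) (m+[n∸m]≡n d≤n) ⟩
    (j + n) % n              ≡⟨ [m+n]%n≡m%n j n ⟩
    j % n                    ∎))
    where open ≡-Reasoning

  splitAt-vtx : ∀ s i → splitAt n (vtx s i) ≡ side s (idx i)
  splitAt-vtx s i = FP.splitAt-join n n (side s (idx i))

  vtx≡vtx⇒side≡side : ∀ s t i j → vtx s i ≡ vtx t j → side s (idx i) ≡ side t (idx j)
  vtx≡vtx⇒side≡side s t i j e = trans (sym (splitAt-vtx s i)) (trans (cong (splitAt n) e) (splitAt-vtx t j))

  side-injective : ∀ s {a b} → side s a ≡ side s b → a ≡ b
  side-injective true  refl = refl
  side-injective false refl = refl

  side≢side-not : ∀ s {a b} → side s a ≢ side (not s) b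
  side≢side-not true  ()
  side≢side-not false ()

  vtx-injective : ∀ s i j → vtx s i ≡ vtx s j → i % n ≡ j % n
  vtx-injective s i j e =
    trans (sym (toℕ-idx i)) (trans (cong toℕ (side-injective s (vtx≡vtx⇒side≡side s s i j e))) (toℕ-idx j))

  vtx≢vtx-not : ∀ s i j → vtx s i ≢ vtx (not s) j
  vtx≢vtx-not s i j = side≢side-not s ∘ vtx≡vtx⇒side≡side s (not s) i j

  vtx-not≢vtx : ∀ s i j → vtx (not s) i ≢ vtx s j
  vtx-not≢vtx s i j = vtx≢vtx-not s j i ∘ sym

  vtx≡vtx⇒%≡ : ∀ s t i j → vtx s i ≡ vtx t j → i % n ≡ j % n
  vtx≡vtx⇒%≡ true  true  = vtx-injective true
  vtx≡vtx⇒%≡ true  false = λ i j → ⊥-elim ∘ vtx≢vtx-not true i j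
  vtx≡vtx⇒%≡ false true  = λ i j → ⊥-elim ∘ vtx≢vtx-not false i j
  vtx≡vtx⇒%≡ false false = vtx-injective false

  vtx-shift-≢ : ∀ s x {d} → 0 < d → d < n → vtx s (d + x) ≢ vtx s x
  vtx-shift-≢ s x {d} 0<d d<n = [d+x]%n≢x%n x 0<d d<n ∘ vtx-injective s (d + x) x

  suc-toℕ-idx : ∀ i → suc (toℕ (idx i)) % n ≡ suc i % n
  suc-toℕ-idx i = trans (cong (λ z → suc z % n) (toℕ-idx i)) (suc-% {n} i)

  cycleAdj-succ : ∀ i → CycleAdj n (idx i) (idx (suc i))
  cycleAdj-succ i = inj₁ (trans (toℕ-idx (suc i)) (sym (suc-toℕ-idx i)))

  cycleAdj-succ⁻ : ∀ i j → CycleAdj n (idx (suc i)) (idx j) → j % n ≡ (2 + i) % n ⊎ j % n ≡ i % n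
  cycleAdj-succ⁻ i j (inj₁ e) = inj₁ (trans (sym (toℕ-idx j)) (trans e (suc-toℕ-idx (suc i))))
  cycleAdj-succ⁻ i j (inj₂ e) =
    inj₂ (sym (suc-injective-% {n} {i} {j} (trans (sym (toℕ-idx (suc i))) (trans e (suc-toℕ-idx j)))))

  PrismAdj'-sym : ∀ x y → PrismAdj' n x y → PrismAdj' n y x
  PrismAdj'-sym (inj₁ a) (inj₁ b) = Sum.swap
  PrismAdj'-sym (inj₁ a) (inj₂ b) = sym
  PrismAdj'-sym (inj₂ a) (inj₁ b) = sym
  PrismAdj'-sym (inj₂ a) (inj₂ b) = Sum.swap

  PrismAdj'-same : ∀ s {a b} → CycleAdj n a b → PrismAdj' n (side s a) (side s b)
  PrismAdj'-same true  c = c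
  PrismAdj'-same false c = c

  PrismAdj'-across : ∀ s a → PrismAdj' n (side s a) (side (not s) a)
  PrismAdj'-across true  a = refl
  PrismAdj'-across false a = refl

  PrismAdj'-side⁻ : ∀ s t {a b} → PrismAdj' n (side s a) (side t b) →
                    (t ≡ s × CycleAdj n a b) ⊎ (t ≡ not s × a ≡ b)
  PrismAdj'-side⁻ true  true  c = inj₁ (refl , c)
  PrismAdj'-side⁻ true  false e = inj₂ (refl , e)
  PrismAdj'-side⁻ false true  e = inj₂ (refl , e)
  PrismAdj'-side⁻ false false c = inj₁ (refl , c)

  G-sym : ∀ a b → G a b → G b a
  G-sym a b = PrismAdj'-sym (splitAt n a) (splitAt n b)

  G-vtx : ∀ s t i j → G (vtx s i) (vtx t j) ≡ PrismAdj' n (side s (idx i)) (side t (idx j))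
  G-vtx s t i j = cong₂ (PrismAdj' n) (splitAt-vtx s i) (splitAt-vtx t j)

  adj-next : ∀ s i → G (vtx s i) (vtx s (suc i))
  adj-next s i = subst id (sym (G-vtx s s i (suc i))) (PrismAdj'-same s (cycleAdj-succ i))

  adj-prev : ∀ s i → G (vtx s (suc i)) (vtx s i)
  adj-prev s i = G-sym (vtx s i) (vtx s (suc i)) (adj-next s i)

  adj-across : ∀ s i → G (vtx s i) (vtx (not s) i)
  adj-across s i = subst id (sym (G-vtx s (not s) i i)) (PrismAdj'-across s (idx i))

  neighbourhood : Bool → ℕ → List V
  neighbourhood s i = vtx s (2 + i) ∷ vtx s i ∷ vtx (not s) (suc i) ∷ []

  neighbours : ∀ s i v → G (vtx s (suc i)) v → v ∈ₗ neighbourhood s i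
  neighbours s i v g with vtx-surjective v
  ... | t , j , _ , refl with PrismAdj'-side⁻ s t (subst id (G-vtx s t (suc i) j) g)
  ... | inj₁ (refl , c) = Sum.[ here ∘ vtx-cong s {j} {2 + i} , there ∘ here ∘ vtx-cong s {j} {i} ] (cycleAdj-succ⁻ i j c)
  ... | inj₂ (refl , e) = there (there (here (cong (F.join n n ∘ side (not s)) (sym e))))

  adj-neighbourhood : ∀ s i → All (G (vtx s (suc i))) (neighbourhood s i)
  adj-neighbourhood s i = adj-next s (suc i) ∷ adj-prev s i ∷ adj-across s (suc i) ∷ []

  module Forcing {B L : Subset (n + n)} where
    private
      C : V → Set
      C = Colored G B L

    force-next : ∀ s i → C (vtx s (suc i)) → vtx s (suc i) ∉ L →
                 C (vtx s i) → C (vtx (not s) (suc i)) → C (vtx s (2 + i))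
    force-next s i cw w∉L cprev cacross = force′ cw w∉L (adj-next s (suc i)) λ u wu →
      case neighbours s i u wu of λ where
      (here e)                 → inj₁ e
      (there (here e))         → inj₂ (subst C (sym e) cprev)
      (there (there (here e))) → inj₂ (subst C (sym e) cacross)

    force-prev : ∀ s i → C (vtx s (suc i)) → vtx s (suc i) ∉ L →
                 C (vtx s (2 + i)) → C (vtx (not s) (suc i)) → C (vtx s i)
    force-prev s i cw w∉L cnext cacross = force′ cw w∉L (adj-prev s i) λ u wu →
      case neighbours s i u wu of λ where
      (here e)                 → inj₂ (subst C (sym e) cnext)
      (there (here e))         → inj₁ e
      (there (there (here e))) → inj₂ (subst C (sym e) cacross)

    force-across : ∀ s i → C (vtx s (suc i)) → vtx s (suc i) ∉ L →
                   C (vtx s (2 + i)) → C (vtx s i) → C (vtx (not s) (suc i))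
    force-across s i cw w∉L cnext cprev = force′ cw w∉L (adj-across s (suc i)) λ u wu →
      case neighbours s i u wu of λ where
      (here e)                 → inj₂ (subst C (sym e) cnext)
      (there (here e))         → inj₂ (subst C (sym e) cprev)
      (there (there (here e))) → inj₁ e

  isLeakyForcingSet≥3⇒⊤ : ∀ {ℓ B} → 3 ≤ ℓ → IsLeakyForcingSet G ℓ B → ∀ v → v ∈ B
  isLeakyForcingSet≥3⇒⊤ {B = B} 3≤ℓ forcing v with vtx-surjective-+ 1 (<⇒≤ 1<n) v
  ... | s , i , refl = decidable-stable (vtx s (suc i) ∈? B) λ w∉B →
    uncolored-if-neighbours-leak w∉B (λ u uw → ∈fromList⁺ (neighbours s i u (G-sym u (vtx s (suc i)) uw)))
      (forcing (fromList (neighbourhood s i)) (≤-trans (∣fromList∣≤length (neighbourhood s i)) 3≤ℓ) _)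

  isLeakyForcingSet≥3⇒2n≤∣B∣ : ∀ {ℓ B} → 3 ≤ ℓ → IsLeakyForcingSet G ℓ B → n + n ≤ ∣ B ∣
  isLeakyForcingSet≥3⇒2n≤∣B∣ {B = B} 3≤ℓ forcing = ≤-reflexive (sym (∀∈⇒∣p∣≡n B (isLeakyForcingSet≥3⇒⊤ 3≤ℓ forcing)))

  -- Centred at vtx s (2 + c), so that both of its cycle neighbours have the form vtx s (suc _).
  closedNeighbourhood : Bool → ℕ → List V
  closedNeighbourhood s c = vtx s (2 + c) ∷ neighbourhood s (suc c)

  closedNeighbourhood-unique : ∀ s c → Unique (closedNeighbourhood s c)
  closedNeighbourhood-unique s c =
      (vtx-shift-≢ s (2 + c) z<s 1<n ∘ sym ∷ vtx-shift-≢ s (1 + c) z<s 1<n ∷ vtx≢vtx-not s (2 + c) (2 + c) ∷ [])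
    ∷ (vtx-shift-≢ s (1 + c) z<s 2<n ∷ vtx≢vtx-not s (3 + c) (2 + c) ∷ [])
    ∷ (vtx≢vtx-not s (1 + c) (2 + c) ∷ [])
    ∷ [] ∷ []

  vtx∉closedNeighbourhood : ∀ s c j → vtx s j ≢ vtx s (2 + c) → vtx s j ≢ vtx s (3 + c) → vtx s j ≢ vtx s (1 + c) →
                            vtx s j ∉ₗ closedNeighbourhood s c
  vtx∉closedNeighbourhood s c j ≢w ≢next ≢prev = λ where
    (here e)                         → ≢w e
    (there (here e))                 → ≢next e
    (there (there (here e)))         → ≢prev e
    (there (there (there (here e)))) → vtx≢vtx-not s j (2 + c) e

  vtx-not∉closedNeighbourhood : ∀ s c j → vtx (not s) j ≢ vtx (not s) (2 + c) →
                                vtx (not s) j ∉ₗ closedNeighbourhood s c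
  vtx-not∉closedNeighbourhood s c j ≢across = λ where
    (here e)                         → vtx-not≢vtx s j (2 + c) e
    (there (here e))                 → vtx-not≢vtx s j (3 + c) e
    (there (there (here e)))         → vtx-not≢vtx s j (1 + c) e
    (there (there (there (here e)))) → ≢across e

  firstForce⇒cover : ∀ {B} → FirstForce G B → ∃₂ λ s c → ∃ λ v → Covers B AllBut v (closedNeighbourhood s c)
  firstForce⇒cover (w , v , w∈B , wv , v∉B , others) with vtx-surjective-+ 2 (<⇒≤ 2<n) w
  ... | s , c , refl = s , c , v , λ where
    (here refl)   _   → w∈B
    (there y∈nbh) y≢v → others _ (All.lookup (adj-neighbourhood s (suc c)) y∈nbh) y≢v

  isLeakyForcingSet⇒3≤∣B∣ : ∀ {ℓ B} → IsLeakyForcingSet G ℓ B → 3 ≤ ∣ B ∣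
  isLeakyForcingSet⇒3≤∣B∣ {B = B} forcing = decidable-stable (3 ≤? ∣ B ∣) λ ∣B∣≱3 →
    isLeakyForcingSet⇒firstForce {G = G} forcing (≤-trans (≰⇒> ∣B∣≱3) (≤-trans (n≤1+n 3) 4≤n+n)) λ first →
      let s , c , v , cover = firstForce⇒cover first
      in ∣B∣≱3 (≤-pred (length≤1+∣p∣ (closedNeighbourhood-unique s c) cover))

  -- Every vertex of N[w] other than w has two neighbours outside N[w], except that the cycle neighbours of
  -- w have only one when n = 3; so such a vertex never forces out of N[w] unless it leaks.
  closedNeighbourhood-forceClosed : ∀ {L} s c → 4 ≤ n ⊎ (vtx s (3 + c) ∈ L × vtx s (1 + c) ∈ L) →
                                    ForceClosed G L (_∈ₗ closedNeighbourhood s c)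
  closedNeighbourhood-forceClosed s c _ {v = v} (here refl) _ wv _ = there (neighbours s (suc c) v wv)
  closedNeighbourhood-forceClosed s c (inj₂ (next∈L , _)) (there (here refl)) next∉L _ _ = ⊥-elim (next∉L next∈L)
  closedNeighbourhood-forceClosed s c (inj₁ 4≤n) {v = v} (there (here refl)) _ nv others
    with neighbours s (2 + c) v nv
  ... | here refl =
    ⊥-elim (vtx-not∉closedNeighbourhood s c (3 + c) (vtx-shift-≢ (not s) (2 + c) z<s 1<n)
      (others _ (adj-across s (3 + c)) (vtx-not≢vtx s (3 + c) (4 + c))))
  ... | there (here refl) = here refl
  ... | there (there (here refl)) =
    ⊥-elim (vtx∉closedNeighbourhood s c (4 + c) (vtx-shift-≢ s (2 + c) z<s 2<n) (vtx-shift-≢ s (3 + c) z<s 1<n)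
      (vtx-shift-≢ s (1 + c) z<s 4≤n) (others _ (adj-next s (3 + c)) (vtx≢vtx-not s (4 + c) (3 + c))))
  closedNeighbourhood-forceClosed s c (inj₂ (_ , prev∈L)) (there (there (here refl))) prev∉L _ _ = ⊥-elim (prev∉L prev∈L)
  closedNeighbourhood-forceClosed s c (inj₁ 4≤n) {v = v} (there (there (here refl))) _ pv others
    with neighbours s c v pv
  ... | here refl = here refl
  ... | there (here refl) =
    ⊥-elim (vtx-not∉closedNeighbourhood s c (1 + c) (vtx-shift-≢ (not s) (1 + c) z<s 1<n ∘ sym)
      (others _ (adj-across s (1 + c)) (vtx-not≢vtx s (1 + c) c)))
  ... | there (there (here refl)) =
    ⊥-elim (vtx∉closedNeighbourhood s c c (vtx-shift-≢ s c z<s 2<n ∘ sym) (vtx-shift-≢ s c z<s 4≤n ∘ sym)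
      (vtx-shift-≢ s c z<s 1<n ∘ sym) (others _ (adj-prev s c) (vtx≢vtx-not s c (1 + c))))
  closedNeighbourhood-forceClosed s c _ {v = v} (there (there (there (here refl)))) _ av others
    with neighbours (not s) (1 + c) v av
  ... | here refl =
    ⊥-elim (vtx-not∉closedNeighbourhood s c (1 + c) (vtx-shift-≢ (not s) (1 + c) z<s 1<n ∘ sym)
      (others _ (adj-prev (not s) (1 + c)) (vtx-shift-≢ (not s) (1 + c) z<s 2<n ∘ sym)))
  ... | there (here refl) =
    ⊥-elim (vtx-not∉closedNeighbourhood s c (3 + c) (vtx-shift-≢ (not s) (2 + c) z<s 1<n)
      (others _ (adj-next (not s) (2 + c)) (vtx-shift-≢ (not s) (1 + c) z<s 2<n)))
  ... | there (there (here refl)) = here (cong (λ t → vtx t (2 + c)) (not-involutive s))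

  isLeakyForcingSet⇒4≤∣B∣ : ∀ {ℓ B} → IsLeakyForcingSet G ℓ B →
                            (∀ s c → Σ (Subset (n + n)) λ L → ∣ L ∣ ≤ ℓ × ForceClosed G L (_∈ₗ closedNeighbourhood s c)) →
                            4 ≤ ∣ B ∣
  isLeakyForcingSet⇒4≤∣B∣ {B = B} forcing closing = decidable-stable (4 ≤? ∣ B ∣) λ ∣B∣≱4 →
    isLeakyForcingSet⇒firstForce {G = G} forcing (≤-trans (≰⇒> ∣B∣≱4) 4≤n+n) λ first →
      let s , c , v , cover = firstForce⇒cover first
          L , ∣L∣≤ℓ , closed = closing s c
      in vtx-not∉closedNeighbourhood s c c (vtx-shift-≢ (not s) c z<s 2<n ∘ sym)
           (Colored-ind _ (∈-if-∣p∣<length (closedNeighbourhood-unique s c) cover (≰⇒> ∣B∣≱4)) closed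
             (forcing L ∣L∣≤ℓ (vtx (not s) c)))

  isLeakyForcingSet⇒4≤∣B∣-4≤n : 4 ≤ n → ∀ {ℓ B} → IsLeakyForcingSet G ℓ B → 4 ≤ ∣ B ∣
  isLeakyForcingSet⇒4≤∣B∣-4≤n 4≤n forcing = isLeakyForcingSet⇒4≤∣B∣ forcing λ s c →
    ⊥ , subst (_≤ _) (sym (∣⊥∣≡0 (n + n))) z≤n , closedNeighbourhood-forceClosed s c (inj₁ 4≤n)

  isLeakyForcingSet₂⇒4≤∣B∣ : ∀ {B} → IsLeakyForcingSet G 2 B → 4 ≤ ∣ B ∣
  isLeakyForcingSet₂⇒4≤∣B∣ forcing = isLeakyForcingSet⇒4≤∣B∣ forcing λ s c →
    let leaks = vtx s (3 + c) ∷ vtx s (1 + c) ∷ []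
    in fromList leaks , ∣fromList∣≤length leaks ,
       closedNeighbourhood-forceClosed s c
         (inj₂ (∈fromList⁺ {xs = leaks} (here refl) , ∈fromList⁺ {xs = leaks} (there (here refl))))

  cycleU : Subset (n + n)
  cycleU = ⊤ {n} ++ ⊥ {n}

  ∣cycleU∣≡n : ∣ cycleU ∣ ≡ n
  ∣cycleU∣≡n = ∣⊤++⊥∣≡m n n

  leftBlock rightBlock : ℕ → List V
  leftBlock  e = vtx true (2 + e) ∷ vtx true (1 + e) ∷ vtx false (2 + e) ∷ []
  rightBlock e = vtx true (4 + e) ∷ vtx true (5 + e) ∷ vtx false (4 + e) ∷ []

  module _ (L : Subset (n + n)) where
    open Forcing {cycleU} {L}

    private
      C : V → Set
      C = Colored G cycleU L

      colored-u : ∀ i → C (vtx true i)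
      colored-u i = initial (↑ˡ∈⊤++⊥ n (idx i))

      colored-x : ∀ i → vtx true (suc i) ∉ L → C (vtx false (suc i))
      colored-x i u∉L = force-across true i (colored-u (suc i)) u∉L (colored-u (2 + i)) (colored-u i)

    -- Routes to x₃₊ₑ: across from u₃₊ₑ, or along the x-cycle from x₂₊ₑ or x₄₊ₑ if their block is leak-free.
    cycleU-colors-x : ∀ e → vtx true (3 + e) ∉ L ⊎ All (_∉ L) (leftBlock e) ⊎ All (_∉ L) (rightBlock e) →
                      C (vtx false (3 + e))
    cycleU-colors-x e (inj₁ u∉L) = colored-x (2 + e) u∉L
    cycleU-colors-x e (inj₂ (inj₁ (u₂∉L ∷ u₁∉L ∷ x₂∉L ∷ []))) =
      force-next false (1 + e) (colored-x (1 + e) u₂∉L) x₂∉L (colored-x e u₁∉L) (colored-u (2 + e))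
    cycleU-colors-x e (inj₂ (inj₂ (u₄∉L ∷ u₅∉L ∷ x₄∉L ∷ []))) =
      force-prev false (3 + e) (colored-x (3 + e) u₄∉L) x₄∉L (colored-x (4 + e) u₅∉L) (colored-u (4 + e))

    cycleU-colors : (∀ e → vtx true (3 + e) ∉ L ⊎ All (_∉ L) (leftBlock e) ⊎ All (_∉ L) (rightBlock e)) →
                    ∀ v → C v
    cycleU-colors options v with vtx-surjective-+ 3 (s≤s (s≤s (s≤s z≤n))) v
    ... | true  , e , refl = colored-u (3 + e)
    ... | false , e , refl = cycleU-colors-x e (options e)

  u₃≢leftBlock : ∀ e {a} → a ∈ₗ leftBlock e → vtx true (3 + e) ≢ a
  u₃≢leftBlock e (here refl)                 = vtx-shift-≢ true (2 + e) z<s 1<n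
  u₃≢leftBlock e (there (here refl))         = vtx-shift-≢ true (1 + e) z<s 2<n
  u₃≢leftBlock e (there (there (here refl))) = vtx≢vtx-not true (3 + e) (2 + e)

  u₃≢rightBlock : ∀ e {b} → b ∈ₗ rightBlock e → vtx true (3 + e) ≢ b
  u₃≢rightBlock e (here refl)                 = vtx-shift-≢ true (3 + e) z<s 1<n ∘ sym
  u₃≢rightBlock e (there (here refl))         = vtx-shift-≢ true (3 + e) z<s 2<n ∘ sym
  u₃≢rightBlock e (there (there (here refl))) = vtx≢vtx-not true (3 + e) (4 + e)

  leftBlock≢rightBlock : 5 ≤ n → ∀ e {a b} → a ∈ₗ leftBlock e → b ∈ₗ rightBlock e → a ≢ b
  leftBlock≢rightBlock 5≤n e = go
    where
    3<n : 3 < n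
    3<n = ≤-trans (n≤1+n 4) 5≤n
    go : ∀ {a b} → a ∈ₗ leftBlock e → b ∈ₗ rightBlock e → a ≢ b
    go (here refl)                 (here refl)                 = vtx-shift-≢ true (2 + e) z<s 2<n ∘ sym
    go (here refl)                 (there (here refl))         = vtx-shift-≢ true (2 + e) z<s 3<n ∘ sym
    go (here refl)                 (there (there (here refl))) = vtx≢vtx-not true (2 + e) (4 + e)
    go (there (here refl))         (here refl)                 = vtx-shift-≢ true (1 + e) z<s 3<n ∘ sym
    go (there (here refl))         (there (here refl))         = vtx-shift-≢ true (1 + e) z<s 5≤n ∘ sym
    go (there (here refl))         (there (there (here refl))) = vtx≢vtx-not true (1 + e) (4 + e)
    go (there (there (here refl))) (here refl)                 = vtx≢vtx-not false (2 + e) (4 + e)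
    go (there (there (here refl))) (there (here refl))         = vtx≢vtx-not false (2 + e) (5 + e)
    go (there (there (here refl))) (there (there (here refl))) = vtx-shift-≢ false (2 + e) z<s 2<n ∘ sym

  cycleU-isLeakyForcingSet₁ : IsLeakyForcingSet G 1 cycleU
  cycleU-isLeakyForcingSet₁ L ∣L∣≤1 = cycleU-colors L options
    where
    options : ∀ e → vtx true (3 + e) ∉ L ⊎ All (_∉ L) (leftBlock e) ⊎ All (_∉ L) (rightBlock e)
    options e with vtx true (3 + e) ∈? L
    ... | no  u∉L = inj₁ u∉L
    ... | yes u∈L with some∈⊎all∉ L (rightBlock e)
    ...   | inj₂ freeR           = inj₂ (inj₂ freeR)
    ...   | inj₁ (b , b∈r , b∈L) =
      ⊥-elim (<⇒≱ (length≤∣p∣ ((u₃≢rightBlock e b∈r ∷ []) ∷ [] ∷ []) (u∈L ∷ b∈L ∷ [])) ∣L∣≤1)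

  cycleU-isLeakyForcingSet₂ : 5 ≤ n → IsLeakyForcingSet G 2 cycleU
  cycleU-isLeakyForcingSet₂ 5≤n L ∣L∣≤2 = cycleU-colors L options
    where
    options : ∀ e → vtx true (3 + e) ∉ L ⊎ All (_∉ L) (leftBlock e) ⊎ All (_∉ L) (rightBlock e)
    options e with vtx true (3 + e) ∈? L
    ... | no  u∉L = inj₁ u∉L
    ... | yes u∈L with some∈⊎all∉ L (leftBlock e) | some∈⊎all∉ L (rightBlock e)
    ...   | inj₂ freeL           | _                    = inj₂ (inj₁ freeL)
    ...   | inj₁ _               | inj₂ freeR           = inj₂ (inj₂ freeR)
    ...   | inj₁ (a , a∈l , a∈L) | inj₁ (b , b∈r , b∈L) =
      ⊥-elim (<⇒≱ (length≤∣p∣ u-a-b-unique (u∈L ∷ a∈L ∷ b∈L ∷ [])) ∣L∣≤2)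
      where
      u-a-b-unique : Unique (vtx true (3 + e) ∷ a ∷ b ∷ [])
      u-a-b-unique = (u₃≢leftBlock e a∈l ∷ u₃≢rightBlock e b∈r ∷ []) ∷ (leftBlock≢rightBlock 5≤n e a∈l b∈r ∷ []) ∷ [] ∷ []

  ladder : List V
  ladder = vtx true 0 ∷ vtx true 1 ∷ vtx false 0 ∷ vtx false 1 ∷ []

  ∣ladder∣≡4 : ∣ fromList ladder ∣ ≡ 4
  ∣ladder∣≡4 = ∣fromList∣≡length
      ((vtx-shift-≢ true 0 z<s 1<n ∘ sym ∷ vtx≢vtx-not true 0 0 ∷ vtx≢vtx-not true 0 1 ∷ [])
    ∷ (vtx≢vtx-not true 1 0 ∷ vtx≢vtx-not true 1 1 ∷ [])
    ∷ (vtx-shift-≢ false 0 z<s 1<n ∘ sym ∷ [])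
    ∷ [] ∷ [])

  module _ (L : Subset (n + n)) where
    open Forcing {fromList ladder} {L}

    private
      C : V → Set
      C = Colored G (fromList ladder) L

    ColumnFree : ℕ → Set
    ColumnFree j = ∀ s → vtx s j ∉ L

    ColumnsColored : ℕ → Set
    ColumnsColored t = ∀ s → C (vtx s t) × C (vtx s (suc t))

    columns-0-1 : ColumnsColored 0
    columns-0-1 true  = initial (∈fromList⁺ {xs = ladder} (here refl)) ,
                        initial (∈fromList⁺ {xs = ladder} (there (here refl)))
    columns-0-1 false = initial (∈fromList⁺ {xs = ladder} (there (there (here refl)))) ,
                        initial (∈fromList⁺ {xs = ladder} (there (there (there (here refl)))))

    columns-n-1+n : ColumnsColored n
    columns-n-1+n s = subst C (vtx-cong s {0} {n} (sym (n%n≡0 n))) (proj₁ (columns-0-1 s)) ,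
                      subst C (vtx-cong s {1} {suc n} (sym ([m+n]%n≡m%n 1 n))) (proj₂ (columns-0-1 s))

    sweep-forward : ∀ t → (∀ j → 1 ≤ j → j ≤ t → ColumnFree j) → ColumnsColored t
    sweep-forward zero    _    = columns-0-1
    sweep-forward (suc t) free s =
      proj₂ (cols s) , force-next s t (proj₂ (cols s)) (free (suc t) z<s ≤-refl s) (proj₁ (cols s)) (proj₂ (cols (not s)))
      where
      cols : ColumnsColored t
      cols = sweep-forward t (λ j 1≤j j≤t → free j 1≤j (m≤n⇒m≤1+n j≤t))

    sweep-backward : ∀ d t → d + t ≡ n → (∀ j → t < j → j ≤ n → ColumnFree j) → ColumnsColored t
    sweep-backward zero    t refl _    = columns-n-1+n
    sweep-backward (suc d) t d+t≡n free s =
      force-prev s t (proj₁ (cols s)) (free (suc t) ≤-refl 1+t≤n s) (proj₂ (cols s)) (proj₁ (cols (not s))) , proj₁ (cols s)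
      where
      1+t≤n : suc t ≤ n
      1+t≤n = subst (suc t ≤_) d+t≡n (s≤s (m≤n+m t d))
      cols : ColumnsColored (suc t)
      cols = sweep-backward d (suc t) (trans (+-suc d t) d+t≡n) (λ j 1+t<j j≤n → free j (<-trans (n<1+n t) 1+t<j) j≤n)

    -- Column n is column 0, so the single leaky column c can be taken in [1, n].
    ladder-colors : ∀ {c} → 1 ≤ c → c ≤ n → (∀ j → 1 ≤ j → j ≤ n → j ≢ c → ColumnFree j) → ∀ v → C v
    ladder-colors {c} 1≤c c≤n free v with vtx-surjective v
    ... | s , zero  , _     , refl = proj₁ (columns-0-1 s)
    ... | s , suc j , 1+j<n , refl with suc j ≤? c
    ...   | yes 1+j≤c =
      proj₂ (sweep-forward j (λ i 1≤i i≤j → free i 1≤i (≤-trans i≤j j≤n) (<⇒≢ (≤-trans (s≤s i≤j) 1+j≤c))) s)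
      where
      j≤n : j ≤ n
      j≤n = <⇒≤ (<-trans (n<1+n j) 1+j<n)
    ...   | no  1+j≰c = proj₁ (sweep-backward (n ∸ suc j) (suc j) (m∸n+n≡m (<⇒≤ 1+j<n))
                          (λ i 1+j<i i≤n → free i (≤-trans z<s (<⇒≤ 1+j<i)) i≤n (>⇒≢ (<-trans (≰⇒> 1+j≰c) 1+j<i))) s)

  ladder-isLeakyForcingSet₁ : IsLeakyForcingSet G 1 (fromList ladder)
  ladder-isLeakyForcingSet₁ L ∣L∣≤1 with ∣p∣≤1⇒⊆singleton (vtx true 0) ∣L∣≤1
  ... | leak , onlyLeak with vtx-surjective leak
  ... | t , m , m<n , refl with %-representative-[1,n] m m<n
  ... | c , 1≤c , c≤n , c≡m = ladder-colors L 1≤c c≤n free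
    where
    free : ∀ j → 1 ≤ j → j ≤ n → j ≢ c → ∀ s → vtx s j ∉ L
    free j 1≤j j≤n j≢c s j∈L = j≢c (%-injective-[1,n] 1≤j j≤n 1≤c c≤n (trans j≡m (sym c≡m)))
      where
      j≡m : j % n ≡ m % n
      j≡m = vtx≡vtx⇒%≡ s t j m (decidable-stable (vtx s j F.≟ vtx t m) (λ ≢leak → onlyLeak ≢leak j∈L))

module Prism₃ where
  open Prism 0

  ladder-isLeakyForcingSet₂ : IsLeakyForcingSet G 2 (fromList ladder)
  ladder-isLeakyForcingSet₂ L ∣L∣≤2 v with vtx-surjective v
  ... | s , 0 , _ , refl = proj₁ (columns-0-1 L s)
  ... | s , 1 , _ , refl = proj₂ (columns-0-1 L s)
  ... | s , suc (suc (suc _)) , s≤s (s≤s (s≤s ())) , _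
  ... | s , 2 , _ , refl = column₂ s
    where
    open Forcing {fromList ladder} {L}

    C : V → Set
    C = Colored G (fromList ladder) L

    colored₀ : ∀ s → C (vtx s 0)
    colored₀ s = proj₁ (columns-0-1 L s)

    colored₁ : ∀ s → C (vtx s 1)
    colored₁ s = proj₂ (columns-0-1 L s)

    colored₃ : ∀ s → C (vtx s 3)
    colored₃ s = subst C (vtx-cong s {0} {3} refl) (colored₀ s)

    colored₄ : ∀ s → C (vtx s 4)
    colored₄ s = subst C (vtx-cong s {1} {4} refl) (colored₁ s)

    column₂-direct : ∀ s → vtx s 1 ∉ L ⊎ vtx s 0 ∉ L → C (vtx s 2)
    column₂-direct s (inj₁ u₁∉L) = force-next s 0 (colored₁ s) u₁∉L (colored₀ s) (colored₁ (not s))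
    column₂-direct s (inj₂ u₀∉L) =
      force-prev s 2 (colored₃ s) (u₀∉L ∘ subst (_∈ L) (vtx-cong s {3} {0} refl)) (colored₄ s) (colored₃ (not s))

    column₂ : ∀ s → C (vtx s 2)
    column₂ s with vtx s 1 ∈? L | vtx s 0 ∈? L
    ... | no  u₁∉L | _        = column₂-direct s (inj₁ u₁∉L)
    ... | yes _    | no  u₀∉L = column₂-direct s (inj₂ u₀∉L)
    ... | yes u₁∈L | yes u₀∈L = subst (λ t → C (vtx t 2)) (not-involutive s)
      (force-across (not s) 1 (column₂-direct (not s) (inj₁ (other-side-free 1))) (other-side-free 2)
        (colored₃ (not s)) (colored₁ (not s)))
      where
      other-side-free : ∀ j → vtx (not s) j ∉ L
      other-side-free j = ∣p∣≤2⇒∉ {p = L} ∣L∣≤2 u₁∈L u₀∈L (vtx-shift-≢ s 0 z<s 1<n) (vtx≢vtx-not s 1 j) (vtx≢vtx-not s 0 j)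

module Prism₄ where
  open Prism 1

  x₀x₁ : List V
  x₀x₁ = vtx false 0 ∷ vtx false 1 ∷ []

  cycleU+x₀x₁ : Subset 8
  cycleU+x₀x₁ = cycleU ∪ fromList x₀x₁

  ∣cycleU+x₀x₁∣≤6 : ∣ cycleU+x₀x₁ ∣ ≤ 6
  ∣cycleU+x₀x₁∣≤6 =
    ≤-trans (∣p∪q∣≤∣p∣+∣q∣ cycleU (fromList x₀x₁)) (+-mono-≤ (≤-reflexive ∣cycleU∣≡n) (∣fromList∣≤length x₀x₁))

  module _ (L : Subset 8) (∣L∣≤2 : ∣ L ∣ ≤ 2) where
    open Forcing {cycleU+x₀x₁} {L}

    private
      C : V → Set
      C = Colored G cycleU+x₀x₁ L

      colored-u : ∀ i → C (vtx true i)
      colored-u i = initial (x∈p∪q⁺ {p = cycleU} {q = fromList x₀x₁} (inj₁ (↑ˡ∈⊤++⊥ n (idx i))))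

      colored-x₀ : C (vtx false 0)
      colored-x₀ = initial (x∈p∪q⁺ {p = cycleU} {q = fromList x₀x₁} (inj₂ (∈fromList⁺ {xs = x₀x₁} (here refl))))

      colored-x₁ : C (vtx false 1)
      colored-x₁ = initial (x∈p∪q⁺ {p = cycleU} {q = fromList x₀x₁} (inj₂ (∈fromList⁺ {xs = x₀x₁} (there (here refl)))))

    colored-x₂ : vtx true 2 ∉ L ⊎ vtx false 1 ∉ L ⊎ (C (vtx false 3) × vtx false 3 ∉ L) → C (vtx false 2)
    colored-x₂ (inj₁ u₂∉L)               = force-across true 1 (colored-u 2) u₂∉L (colored-u 3) (colored-u 1)
    colored-x₂ (inj₂ (inj₁ x₁∉L))        = force-next false 0 colored-x₁ x₁∉L colored-x₀ (colored-u 1)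
    colored-x₂ (inj₂ (inj₂ (c₃ , x₃∉L))) = force-prev false 2 c₃ x₃∉L colored-x₀ (colored-u 3)

    colored-x₃ : vtx true 3 ∉ L ⊎ vtx false 0 ∉ L ⊎ (C (vtx false 2) × vtx false 2 ∉ L) → C (vtx false 3)
    colored-x₃ (inj₁ u₃∉L)               = force-across true 2 (colored-u 3) u₃∉L (colored-u 4) (colored-u 2)
    colored-x₃ (inj₂ (inj₁ x₀∉L))        = force-prev false 3 colored-x₀ x₀∉L colored-x₁ (colored-u 4)
    colored-x₃ (inj₂ (inj₂ (c₂ , x₂∉L))) = force-next false 1 c₂ x₂∉L colored-x₁ (colored-u 2)

    colored-x₂-x₃ : C (vtx false 2) × C (vtx false 3)
    colored-x₂-x₃ with vtx true 2 ∈? L | vtx true 3 ∈? L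
    ... | no u₂∉L  | no u₃∉L = colored-x₂ (inj₁ u₂∉L) , colored-x₃ (inj₁ u₃∉L)
    ... | yes u₂∈L | no u₃∉L with vtx false 1 ∈? L
    ...   | no  x₁∉L = colored-x₂ (inj₂ (inj₁ x₁∉L)) , colored-x₃ (inj₁ u₃∉L)
    ...   | yes x₁∈L = colored-x₂ (inj₂ (inj₂ (colored-x₃ (inj₁ u₃∉L) , x₃∉L))) , colored-x₃ (inj₁ u₃∉L)
      where
      x₃∉L : vtx false 3 ∉ L
      x₃∉L = ∣p∣≤2⇒∉ {p = L} ∣L∣≤2 u₂∈L x₁∈L (vtx≢vtx-not true 2 1) (vtx≢vtx-not true 2 3)
               (vtx-shift-≢ false 1 z<s 2<n ∘ sym)
    colored-x₂-x₃ | no u₂∉L | yes u₃∈L with vtx false 0 ∈? L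
    ...   | no  x₀∉L = colored-x₂ (inj₁ u₂∉L) , colored-x₃ (inj₂ (inj₁ x₀∉L))
    ...   | yes x₀∈L = colored-x₂ (inj₁ u₂∉L) , colored-x₃ (inj₂ (inj₂ (colored-x₂ (inj₁ u₂∉L) , x₂∉L)))
      where
      x₂∉L : vtx false 2 ∉ L
      x₂∉L = ∣p∣≤2⇒∉ {p = L} ∣L∣≤2 u₃∈L x₀∈L (vtx≢vtx-not true 3 0) (vtx≢vtx-not true 3 2)
               (vtx-shift-≢ false 0 z<s 2<n ∘ sym)
    colored-x₂-x₃ | yes u₂∈L | yes u₃∈L =
      colored-x₂ (inj₂ (inj₁ (x-cycle-free 1))) , colored-x₃ (inj₂ (inj₁ (x-cycle-free 0)))
      where
      x-cycle-free : ∀ j → vtx false j ∉ L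
      x-cycle-free j = ∣p∣≤2⇒∉ {p = L} ∣L∣≤2 u₂∈L u₃∈L (vtx-shift-≢ true 2 z<s 1<n ∘ sym)
                         (vtx≢vtx-not true 2 j) (vtx≢vtx-not true 3 j)

    cycleU+x₀x₁-colors : ∀ v → C v
    cycleU+x₀x₁-colors v with vtx-surjective v
    ... | true  , j , _ , refl = colored-u j
    ... | false , 0 , _ , refl = colored-x₀
    ... | false , 1 , _ , refl = colored-x₁
    ... | false , 2 , _ , refl = proj₁ colored-x₂-x₃
    ... | false , 3 , _ , refl = proj₂ colored-x₂-x₃
    ... | false , suc (suc (suc (suc _))) , s≤s (s≤s (s≤s (s≤s ()))) , _

  cycleU+x₀x₁-isLeakyForcingSet₂ : IsLeakyForcingSet G 2 cycleU+x₀x₁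
  cycleU+x₀x₁-isLeakyForcingSet₂ = cycleU+x₀x₁-colors

theorem1p2 : ∀ (n : ℕ) → 3 ≤ n →
    ((∀ ℓ → ℓ ≤ 1 → n ≡ 3 → LeakyZ≡ (PrismAdj n) ℓ 3)
    × (∀ ℓ → ℓ ≤ 1 → 4 ≤ n → LeakyZ≡ (PrismAdj n) ℓ 4)
    × (n ≡ 3 → LeakyZ≡ (PrismAdj n) 2 4)
    × (∀ ℓ → 3 ≤ ℓ → LeakyZ≡ (PrismAdj n) ℓ (n + n))
    × (n ≡ 4 → LeakyZ≤ (PrismAdj n) 2 6)
    × (4 < n → LeakyZ≤ (PrismAdj n) 2 n))
theorem1p2 .(3 + k) (s≤s (s≤s (s≤s {n = k} z≤n))) =
    (λ ℓ ℓ≤1 n≡3 → (cycleU , isLeakyForcingSet-≤ ℓ≤1 cycleU-isLeakyForcingSet₁ , trans ∣cycleU∣≡n n≡3) ,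
                   λ _ → isLeakyForcingSet⇒3≤∣B∣)
  , (λ ℓ ℓ≤1 4≤n → (fromList ladder , isLeakyForcingSet-≤ ℓ≤1 ladder-isLeakyForcingSet₁ , ∣ladder∣≡4) ,
                   λ _ → isLeakyForcingSet⇒4≤∣B∣-4≤n 4≤n)
  , (λ { refl → (fromList ladder , Prism₃.ladder-isLeakyForcingSet₂ , ∣ladder∣≡4) , λ _ → isLeakyForcingSet₂⇒4≤∣B∣ })
  , (λ ℓ 3≤ℓ → (⊤ , ⊤-isLeakyForcingSet G ℓ , ∣⊤∣≡n (n + n)) , λ _ → isLeakyForcingSet≥3⇒2n≤∣B∣ 3≤ℓ)
  , (λ { refl → Prism₄.cycleU+x₀x₁ , Prism₄.cycleU+x₀x₁-isLeakyForcingSet₂ , Prism₄.∣cycleU+x₀x₁∣≤6 })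
  , (λ 4<n → cycleU , cycleU-isLeakyForcingSet₂ 4<n , ≤-reflexive ∣cycleU∣≡n)
  where open Prism k
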